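{- Let $G$ be a finite simple $d$-regular graph, let $v\in V(G)$ and let $u\in N_2'(v)$. Then $\deg_2(u)\ge d-\deg_2(v)+1$. In particular, if $\deg_2(v)\le 3$, then $\deg_2(u)\ge d-2$.
   Context: $d(x,y)$ is the graph distance. For a vertex $x$ and $i\ge1$, $N_i(x)$ is the set of vertices at distance exactly $i$ from $x$, $N(x)=N_1(x)$, and $\deg_2(x)=|N_2(x)|$. $N_2'(v)$ is the set of vertices $u\in N_2(v)$ that are adjacent to some vertex of $N_3(v)$. -}

module Defs where

open import Data.Nat using (ℕ; zero; suc)
open import Data.Bool using (Bool; true; false; _∧_; _∨_; not)
open import Data.Fin using (Fin; _≟_)
open import Data.Fin.Subset using (Subset; ∣_∣)
open import Data.Vec using (tabulate)

open import Data.List using (allFin)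
open import Data.Bool.ListAction using () renaming (any to anyL)
open import Relation.Nullary using (¬_)
open import Relation.Nullary.Decidable using (isYes)
open import Relation.Binary.PropositionalEquality using (_≡_)

record Graph (n : ℕ) : Set where
  field
    adj   : Fin n → Fin n → Bool
    symm  : ∀ x y → adj x y ≡ adj y x
    irrefl : ∀ x → adj x x ≡ false

module _ {n : ℕ} (G : Graph n) where
  open Graph G

  N : Fin n → Subset n
  N x = tabulate (adj x)

  deg : Fin n → ℕ
  deg x = ∣ N x ∣

  walk : ℕ → Fin n → Fin n → Bool
  walk zero    x y = isYes (x ≟ y)
  walk (suc k) x y = anyL (λ w → adj x w ∧ walk k w y) (allFin n)

  noShorter : ℕ → Fin n → Fin n → Bool
  noShorter zero    x y = true
  noShorter (suc i) x y = noShorter i x y ∧ not (walk i x y)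

  atDist : ℕ → Fin n → Fin n → Bool
  atDist i x y = walk i x y ∧ noShorter i x y

  Ni : ℕ → Fin n → Subset n
  Ni i x = tabulate (atDist i x)

  deg₂ : Fin n → ℕ
  deg₂ x = ∣ Ni 2 x ∣

  N₂' : Fin n → Fin n → Set
  N₂' v u = (atDist 2 v u ≡ true) × ∃ λ w → (atDist 3 v w ≡ true) × (adj u w ≡ true)
    where open import Data.Product using (_×_; ∃)

Regular : {n : ℕ} → Graph n → ℕ → Set
Regular G d = ∀ x → deg G x ≡ d

module Submission where

-- Let a be a common neighbour of v and u, and w a neighbour of u in N₃(v). The set
-- L = N(v) ∪ W₂(v) of neighbours of v and endpoints of 2-walks from v contains N(a)
-- and u but not w. The neighbours of w in L lie in N₂(v). Those outside L either are
-- neighbours of u outside L, and there are fewer of them than |N(u) ─ L| since w is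
-- such a neighbour but w ∉ N(w), or lie in X = N(w) ─ L ─ N(u) ⊆ N₂(u). Hence
-- d + 1 ≤ deg₂ v + |N(u) ─ L| + |X|. On the other side, N(a) ∩ N(u) misses
-- a ∈ N(u) ∩ L, so |N(u) ─ L| < d − |N(a) ∩ N(u)| = |N(a) ─ N(u)|, and
-- N(a) ─ N(u) − u ⊆ N₂(u) is disjoint from X because it lies inside L.

open import Defs
open import Data.Bool using (Bool; true; false; not; _∧_)
open import Data.Bool.Properties using (∧-conicalˡ; ∧-conicalʳ; not-injective; ¬-not; T-≡; T-∧)
open import Data.Fin using (Fin; _≟_)
open import Data.Fin.Subset
  using (Subset; inside; outside; ∣_∣; _∈_; _∉_; _⊆_; _⊂_; _∩_; _∪_; _─_; _-_; ⁅_⁆)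
open import Data.Fin.Subset.Properties
  using (p⊆q⇒∣p∣≤∣q∣; p⊂q⇒∣p∣<∣q∣; ∣p∩q∣≤∣q∣; ∣⁅x⁆∣≡1; x∈p∩q⁺; x∈p∩q⁻; x∈p∪q⁺; x∈p∪q⁻;
         x∈p∧x∉q⇒x∈p─q; p─q⊆p; x∉⁅y⁆⇒x≢y)
open import Data.List using (allFin)
open import Data.List.Membership.Propositional using (lose)
open import Data.List.Membership.Propositional.Properties using (∈-allFin)
open import Data.List.Relation.Unary.Any using (satisfied)
open import Data.List.Relation.Unary.Any.Properties using (any⁺; any⁻)
open import Data.Nat using (ℕ; zero; suc; _+_; _≤_; _<_; z≤n; s≤s; s≤s⁻¹)
open import Data.Nat.Properties
  using (≤-refl; ≤-trans; ≤-reflexive; +-suc; +-comm; +-assoc; +-monoˡ-≤; +-monoʳ-≤; +-mono-≤;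
         +-cancelˡ-≤; +-cancelʳ-≤; m<n⇒m<1+n; m<1+n⇒m<n∨m≡n; module ≤-Reasoning)
open import Data.Product using (_×_; _,_; ∃; proj₁)
open import Data.Sum using (inj₁; inj₂)
open import Data.Vec using (_∷_; []; tabulate; here; there)
open import Data.Vec.Properties using (lookup∘tabulate; []=⇒lookup; lookup⇒[]=)
open import Function using (_∘_; Equivalence)
open import Relation.Binary.PropositionalEquality using (_≡_; _≢_; refl; sym; trans; cong; cong₂; subst)
open import Relation.Nullary using (yes; no; contradiction)

private
  variable
    n : ℕ

x∈tabulate⁺ : ∀ {f : Fin n → Bool} {x} → f x ≡ true → x ∈ tabulate f
x∈tabulate⁺ {f = f} {x} fx = lookup⇒[]= x (tabulate f) (trans (lookup∘tabulate f x) fx)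

x∈tabulate⁻ : ∀ {f : Fin n → Bool} {x} → x ∈ tabulate f → f x ≡ true
x∈tabulate⁻ {f = f} {x} x∈f = trans (sym (lookup∘tabulate f x)) ([]=⇒lookup x∈f)

x∈p─q⇒x∉q : ∀ {p q : Subset n} {x} → x ∈ p ─ q → x ∉ q
x∈p─q⇒x∉q {p = _ ∷ _} {outside ∷ _} here          ()
x∈p─q⇒x∉q {p = _ ∷ _} {_ ∷ _}       (there x∈p─q) (there x∈q) = x∈p─q⇒x∉q x∈p─q x∈q

∣p∩q∣+∣p─q∣≡∣p∣ : ∀ (p q : Subset n) → ∣ p ∩ q ∣ + ∣ p ─ q ∣ ≡ ∣ p ∣
∣p∩q∣+∣p─q∣≡∣p∣ []            []            = refl
∣p∩q∣+∣p─q∣≡∣p∣ (inside  ∷ p) (inside  ∷ q) = cong suc (∣p∩q∣+∣p─q∣≡∣p∣ p q)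
∣p∩q∣+∣p─q∣≡∣p∣ (inside  ∷ p) (outside ∷ q) =
  trans (+-suc ∣ p ∩ q ∣ ∣ p ─ q ∣) (cong suc (∣p∩q∣+∣p─q∣≡∣p∣ p q))
∣p∩q∣+∣p─q∣≡∣p∣ (outside ∷ p) (inside  ∷ q) = ∣p∩q∣+∣p─q∣≡∣p∣ p q
∣p∩q∣+∣p─q∣≡∣p∣ (outside ∷ p) (outside ∷ q) = ∣p∩q∣+∣p─q∣≡∣p∣ p q

∣p∣≤1+∣p-x∣ : ∀ (p : Subset n) x → ∣ p ∣ ≤ suc ∣ p - x ∣
∣p∣≤1+∣p-x∣ p x = begin
  ∣ p ∣                       ≡⟨ sym (∣p∩q∣+∣p─q∣≡∣p∣ p ⁅ x ⁆) ⟩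
  ∣ p ∩ ⁅ x ⁆ ∣ + ∣ p - x ∣   ≤⟨ +-monoˡ-≤ ∣ p - x ∣ (≤-trans (∣p∩q∣≤∣q∣ p ⁅ x ⁆) (≤-reflexive (∣⁅x⁆∣≡1 x))) ⟩
  suc ∣ p - x ∣               ∎
  where open ≤-Reasoning

disjoint⇒∣p∣+∣q∣≤∣r∣ : ∀ {p q r : Subset n} → p ⊆ r → q ⊆ r → (∀ {x} → x ∈ p → x ∉ q) →
                       ∣ p ∣ + ∣ q ∣ ≤ ∣ r ∣
disjoint⇒∣p∣+∣q∣≤∣r∣ {p = p} {q} {r} p⊆r q⊆r disjoint = begin
  ∣ p ∣ + ∣ q ∣          ≡⟨ +-comm ∣ p ∣ ∣ q ∣ ⟩
  ∣ q ∣ + ∣ p ∣          ≤⟨ +-mono-≤ (p⊆q⇒∣p∣≤∣q∣ q⊆r∩q) (p⊆q⇒∣p∣≤∣q∣ p⊆r─q) ⟩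
  ∣ r ∩ q ∣ + ∣ r ─ q ∣  ≡⟨ ∣p∩q∣+∣p─q∣≡∣p∣ r q ⟩
  ∣ r ∣                  ∎
  where
  open ≤-Reasoning
  q⊆r∩q : q ⊆ r ∩ q
  q⊆r∩q x∈q = x∈p∩q⁺ (q⊆r x∈q , x∈q)
  p⊆r─q : p ⊆ r ─ q
  p⊆r─q x∈p = x∈p∧x∉q⇒x∈p─q (p⊆r x∈p) (disjoint x∈p)

module _ (G : Graph n) where
  open Graph G

  walk-zero⁻ : ∀ {x y} → walk G 0 x y ≡ true → x ≡ y
  walk-zero⁻ {x} {y} e with x ≟ y
  ... | yes x≡y = x≡y

  walk-zero-refl : ∀ x → walk G 0 x x ≡ true
  walk-zero-refl x with x ≟ x
  ... | yes _   = refl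
  ... | no  x≢x = contradiction refl x≢x

  walk-suc⁺ : ∀ {k x y} z → adj x z ≡ true → walk G k z y ≡ true → walk G (suc k) x y ≡ true
  walk-suc⁺ z xz zy = Equivalence.to T-≡
    (any⁺ _ (lose (∈-allFin z) (Equivalence.from T-∧ (Equivalence.from T-≡ xz , Equivalence.from T-≡ zy))))

  walk-suc⁻ : ∀ {k x y} → walk G (suc k) x y ≡ true → ∃ λ z → adj x z ≡ true × walk G k z y ≡ true
  walk-suc⁻ e with satisfied (any⁻ _ (allFin _) (Equivalence.from T-≡ e))
  ... | z , t with Equivalence.to T-∧ t
  ... | xz , zy = z , Equivalence.to T-≡ xz , Equivalence.to T-≡ zy

  noShorter⁻ : ∀ {i j x y} → noShorter G i x y ≡ true → j < i → walk G j x y ≡ false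
  noShorter⁻ {suc i} {j} {x} {y} e j<1+i with m<1+n⇒m<n∨m≡n j<1+i
  ... | inj₁ j<i  = noShorter⁻ {i} (∧-conicalˡ _ _ e) j<i
  ... | inj₂ refl = not-injective (∧-conicalʳ (noShorter G i x y) _ e)

  noShorter⁺ : ∀ {i x y} → (∀ {j} → j < i → walk G j x y ≡ false) → noShorter G i x y ≡ true
  noShorter⁺ {zero}  _     = refl
  noShorter⁺ {suc i} short = cong₂ _∧_ (noShorter⁺ {i} (short ∘ m<n⇒m<1+n)) (cong not (short ≤-refl))

  walk-one⁺ : ∀ {x y} → adj x y ≡ true → walk G 1 x y ≡ true
  walk-one⁺ {y = y} xy = walk-suc⁺ {k = 0} y xy (walk-zero-refl y)

  walk-one⁻ : ∀ {x y} → walk G 1 x y ≡ true → adj x y ≡ true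
  walk-one⁻ {x} e with walk-suc⁻ {k = 0} e
  ... | z , xz , zy = subst (λ y → adj x y ≡ true) (walk-zero⁻ zy) xz

  atDist⇒¬shorter : ∀ {i j x y} → atDist G i x y ≡ true → j < i → walk G j x y ≡ false
  atDist⇒¬shorter {i} {x = x} {y} e = noShorter⁻ {i} (∧-conicalʳ (walk G i x y) _ e)

  -- Endpoints of walks of length two; unlike N₂(x) it may contain x and N(x).
  W₂ : Fin n → Subset n
  W₂ x = tabulate (walk G 2 x)

  N-sym : ∀ {x y} → y ∈ N G x → x ∈ N G y
  N-sym {x} {y} y∈Nx = x∈tabulate⁺ (trans (symm y x) (x∈tabulate⁻ y∈Nx))

  x∉Nx : ∀ {x} → x ∉ N G x
  x∉Nx {x} x∈Nx with () ← trans (sym (x∈tabulate⁻ x∈Nx)) (irrefl x)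

  W₂⁺ : ∀ {x y z} → z ∈ N G x → y ∈ N G z → y ∈ W₂ x
  W₂⁺ {z = z} z∈Nx y∈Nz =
    x∈tabulate⁺ (walk-suc⁺ {k = 1} z (x∈tabulate⁻ z∈Nx) (walk-one⁺ (x∈tabulate⁻ y∈Nz)))

  W₂⁻ : ∀ {x y} → y ∈ W₂ x → ∃ λ z → z ∈ N G x × y ∈ N G z
  W₂⁻ y∈W₂x with walk-suc⁻ {k = 1} (x∈tabulate⁻ y∈W₂x)
  ... | z , xz , zy = z , x∈tabulate⁺ xz , x∈tabulate⁺ (walk-one⁻ zy)

  N₂⁺ : ∀ {x y} → y ∈ W₂ x → y ≢ x → y ∉ N G x → y ∈ Ni G 2 x
  N₂⁺ {x} {y} y∈W₂x y≢x y∉Nx = x∈tabulate⁺ (cong₂ _∧_ (x∈tabulate⁻ y∈W₂x) (noShorter⁺ {2} shorter))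
    where
    shorter : ∀ {j} → j < 2 → walk G j x y ≡ false
    shorter {0} _ = ¬-not (y≢x ∘ sym ∘ walk-zero⁻)
    shorter {1} _ = ¬-not (y∉Nx ∘ x∈tabulate⁺ ∘ walk-one⁻)
    shorter {suc (suc _)} (s≤s (s≤s ()))

  atDist-two⇒∈W₂ : ∀ {x y} → atDist G 2 x y ≡ true → y ∈ W₂ x
  atDist-two⇒∈W₂ {x} {y} e = x∈tabulate⁺ (∧-conicalˡ _ (noShorter G 2 x y) e)

  atDist-three⇒∉N : ∀ {x y} → atDist G 3 x y ≡ true → y ∉ N G x
  atDist-three⇒∉N e y∈Nx with () ← trans (sym (walk-one⁺ (x∈tabulate⁻ y∈Nx))) (atDist⇒¬shorter {i = 3} e (s≤s (s≤s z≤n)))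

  atDist-three⇒∉W₂ : ∀ {x y} → atDist G 3 x y ≡ true → y ∉ W₂ x
  atDist-three⇒∉W₂ e y∈W₂x with () ← trans (sym (x∈tabulate⁻ y∈W₂x)) (atDist⇒¬shorter {i = 3} e ≤-refl)

module _ {d} (G : Graph n) (regular : Regular G d) {v u w a : Fin n}
         (a∈Nv : a ∈ N G v) (u∈Na : u ∈ N G a) (w∈Nu : w ∈ N G u)
         (w∉Nv : w ∉ N G v) (w∉W₂v : w ∉ W₂ G v) where

  private
    L X Y : Subset n
    L = N G v ∪ W₂ G v
    X = N G w ─ L
    Y = N G a ─ N G u - u

    W₂v⊆L : W₂ G v ⊆ L
    W₂v⊆L = x∈p∪q⁺ ∘ inj₂

    Na⊆L : N G a ⊆ L
    Na⊆L = W₂v⊆L ∘ W₂⁺ G a∈Nv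

    w∉L : w ∉ L
    w∉L w∈L with x∈p∪q⁻ (N G v) (W₂ G v) w∈L
    ... | inj₁ w∈Nv  = w∉Nv w∈Nv
    ... | inj₂ w∈W₂v = w∉W₂v w∈W₂v

    degree-split : ∀ x p → d ≡ ∣ N G x ∩ p ∣ + ∣ N G x ─ p ∣
    degree-split x p = trans (sym (regular x)) (sym (∣p∩q∣+∣p─q∣≡∣p∣ (N G x) p))

    Nw∩L⊆N₂v : N G w ∩ L ⊆ Ni G 2 v
    Nw∩L⊆N₂v x∈Nw∩L with x∈p∩q⁻ (N G w) L x∈Nw∩L
    ... | x∈Nw , x∈L with x∈p∪q⁻ (N G v) (W₂ G v) x∈L
    ...   | inj₁ x∈Nv  = contradiction (W₂⁺ G x∈Nv (N-sym G x∈Nw)) w∉W₂v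
    ...   | inj₂ x∈W₂v = N₂⁺ G x∈W₂v x≢v x∉Nv
      where
      x∉Nv : _ ∉ N G v
      x∉Nv x∈Nv = w∉W₂v (W₂⁺ G x∈Nv (N-sym G x∈Nw))
      x≢v : _ ≢ v
      x≢v refl = w∉Nv (N-sym G x∈Nw)

    X∩Nu⊂Nu─L : X ∩ N G u ⊂ N G u ─ L
    X∩Nu⊂Nu─L = X∩Nu⊆Nu─L , w , x∈p∧x∉q⇒x∈p─q w∈Nu w∉L , w∉X∩Nu
      where
      X∩Nu⊆Nu─L : X ∩ N G u ⊆ N G u ─ L
      X∩Nu⊆Nu─L x∈X∩Nu with x∈p∩q⁻ X (N G u) x∈X∩Nu
      ... | x∈X , x∈Nu = x∈p∧x∉q⇒x∈p─q x∈Nu (x∈p─q⇒x∉q x∈X)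
      w∉X∩Nu : w ∉ X ∩ N G u
      w∉X∩Nu w∈X∩Nu with x∈p∩q⁻ X (N G u) w∈X∩Nu
      ... | w∈X , _ = x∉Nx G (p─q⊆p (N G w) L w∈X)

    Na∩Nu⊂Nu∩L : N G a ∩ N G u ⊂ N G u ∩ L
    Na∩Nu⊂Nu∩L = Na∩Nu⊆Nu∩L , a , x∈p∩q⁺ (N-sym G u∈Na , x∈p∪q⁺ (inj₁ a∈Nv)) , a∉Na∩Nu
      where
      Na∩Nu⊆Nu∩L : N G a ∩ N G u ⊆ N G u ∩ L
      Na∩Nu⊆Nu∩L x∈Na∩Nu with x∈p∩q⁻ (N G a) (N G u) x∈Na∩Nu
      ... | x∈Na , x∈Nu = x∈p∩q⁺ (x∈Nu , Na⊆L x∈Na)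
      a∉Na∩Nu : a ∉ N G a ∩ N G u
      a∉Na∩Nu a∈Na∩Nu = x∉Nx G (proj₁ (x∈p∩q⁻ (N G a) (N G u) a∈Na∩Nu))

    Y⊆N₂u : Y ⊆ Ni G 2 u
    Y⊆N₂u {x} x∈Y = N₂⁺ G (W₂⁺ G (N-sym G u∈Na) x∈Na) x≢u (x∈p─q⇒x∉q x∈Na─Nu)
      where
      x∈Na─Nu : x ∈ N G a ─ N G u
      x∈Na─Nu = p─q⊆p _ ⁅ u ⁆ x∈Y
      x∈Na : x ∈ N G a
      x∈Na = p─q⊆p (N G a) (N G u) x∈Na─Nu
      x≢u : x ≢ u
      x≢u = x∉⁅y⁆⇒x≢y (x∈p─q⇒x∉q x∈Y)

    X─Nu⊆N₂u : X ─ N G u ⊆ Ni G 2 u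
    X─Nu⊆N₂u {x} x∈X─Nu = N₂⁺ G (W₂⁺ G w∈Nu x∈Nw) x≢u (x∈p─q⇒x∉q x∈X─Nu)
      where
      x∈X : x ∈ X
      x∈X = p─q⊆p X (N G u) x∈X─Nu
      x∈Nw : x ∈ N G w
      x∈Nw = p─q⊆p (N G w) L x∈X
      x≢u : x ≢ u
      x≢u refl = x∈p─q⇒x∉q x∈X (W₂v⊆L (W₂⁺ G a∈Nv u∈Na))

    x∈Y⇒x∉X─Nu : ∀ {x} → x ∈ Y → x ∉ X ─ N G u
    x∈Y⇒x∉X─Nu x∈Y x∈X─Nu =
      x∈p─q⇒x∉q (p─q⊆p X (N G u) x∈X─Nu) (Na⊆L (p─q⊆p (N G a) (N G u) (p─q⊆p _ ⁅ u ⁆ x∈Y)))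

    ∣Nu─L∣≤∣Y∣ : ∣ N G u ─ L ∣ ≤ ∣ Y ∣
    ∣Nu─L∣≤∣Y∣ = +-cancelˡ-≤ ∣ N G a ∩ N G u ∣ _ _ (s≤s⁻¹ (begin
      suc (∣ N G a ∩ N G u ∣ + ∣ N G u ─ L ∣)  ≤⟨ +-monoˡ-≤ _ (p⊂q⇒∣p∣<∣q∣ Na∩Nu⊂Nu∩L) ⟩
      ∣ N G u ∩ L ∣ + ∣ N G u ─ L ∣            ≡⟨ sym (degree-split u L) ⟩
      d                                        ≡⟨ degree-split a (N G u) ⟩
      ∣ N G a ∩ N G u ∣ + ∣ N G a ─ N G u ∣    ≤⟨ +-monoʳ-≤ _ (∣p∣≤1+∣p-x∣ (N G a ─ N G u) u) ⟩
      ∣ N G a ∩ N G u ∣ + suc ∣ Y ∣            ≡⟨ +-suc _ _ ⟩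
      suc (∣ N G a ∩ N G u ∣ + ∣ Y ∣)          ∎))
      where open ≤-Reasoning

    1+d≤deg₂v+∣Nu─L∣+∣X─Nu∣ : suc d ≤ deg₂ G v + (∣ N G u ─ L ∣ + ∣ X ─ N G u ∣)
    1+d≤deg₂v+∣Nu─L∣+∣X─Nu∣ = begin
      suc d                                            ≡⟨ cong suc (degree-split w L) ⟩
      suc (∣ N G w ∩ L ∣ + ∣ X ∣)                      ≡⟨ sym (+-suc _ _) ⟩
      ∣ N G w ∩ L ∣ + suc ∣ X ∣                        ≡⟨ cong (λ k → ∣ N G w ∩ L ∣ + suc k) (sym (∣p∩q∣+∣p─q∣≡∣p∣ X (N G u))) ⟩
      ∣ N G w ∩ L ∣ + (suc ∣ X ∩ N G u ∣ + ∣ X ─ N G u ∣)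
        ≤⟨ +-mono-≤ (p⊆q⇒∣p∣≤∣q∣ Nw∩L⊆N₂v) (+-monoˡ-≤ _ (p⊂q⇒∣p∣<∣q∣ X∩Nu⊂Nu─L)) ⟩
      deg₂ G v + (∣ N G u ─ L ∣ + ∣ X ─ N G u ∣)     ∎
      where open ≤-Reasoning

  deg₂-bound : d + 1 ≤ deg₂ G u + deg₂ G v
  deg₂-bound = begin
    d + 1                                        ≡⟨ +-comm d 1 ⟩
    suc d                                        ≤⟨ 1+d≤deg₂v+∣Nu─L∣+∣X─Nu∣ ⟩
    deg₂ G v + (∣ N G u ─ L ∣ + ∣ X ─ N G u ∣)   ≤⟨ +-monoʳ-≤ (deg₂ G v) (+-monoˡ-≤ _ ∣Nu─L∣≤∣Y∣) ⟩
    deg₂ G v + (∣ Y ∣ + ∣ X ─ N G u ∣)           ≤⟨ +-monoʳ-≤ (deg₂ G v) (disjoint⇒∣p∣+∣q∣≤∣r∣ Y⊆N₂u X─Nu⊆N₂u x∈Y⇒x∉X─Nu) ⟩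
    deg₂ G v + deg₂ G u                          ≡⟨ +-comm (deg₂ G v) _ ⟩
    deg₂ G u + deg₂ G v                          ∎
    where open ≤-Reasoning

lemma2p1 : (n d : ℕ) (G : Graph n) → Regular G d → (v u : Fin n) → N₂' G v u →
    (d + 1 ≤ deg₂ G u + deg₂ G v) × (deg₂ G v ≤ 3 → d ≤ deg₂ G u + 2)
lemma2p1 n d G regular v u (v↝u , w , v↝w , uw) = bound , bound-if-deg₂v≤3
  where
  bound : d + 1 ≤ deg₂ G u + deg₂ G v
  bound with W₂⁻ G (atDist-two⇒∈W₂ G v↝u)
  ... | a , a∈Nv , u∈Na =
    deg₂-bound G regular a∈Nv u∈Na (x∈tabulate⁺ uw) (atDist-three⇒∉N G v↝w) (atDist-three⇒∉W₂ G v↝w)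

  bound-if-deg₂v≤3 : deg₂ G v ≤ 3 → d ≤ deg₂ G u + 2
  bound-if-deg₂v≤3 deg₂v≤3 = +-cancelʳ-≤ 1 d (deg₂ G u + 2)
    (≤-trans bound (≤-trans (+-monoʳ-≤ (deg₂ G u) deg₂v≤3) (≤-reflexive (sym (+-assoc (deg₂ G u) 2 1)))))
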